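{- Let $a\mathcal R$ be the group of almost-Riordan arrays, $\mathcal R$ the Riordan group, and $\mathcal N$ the normal subgroup of $a\mathcal R$ consisting of the arrays of the form $(a,1,x)$ with $a_0=1$. Then $a\mathcal R/\mathcal N\cong\mathcal R$ (the coset of $(a,g,f)$ corresponding to the Riordan array $(g,f)$).
   Context: All power series have integer coefficients. For $f$ with $f_0=0$, $f_1=1$, $\bar f$ denotes its series reversion ($\bar f(0)=0$, $f(\bar f(x))=x$). An almost-Riordan array is an ordered triple $(a,g,f)$ of power series with $a_0=1$, $g_0=1$, $f_0=0$, $f_1=1$, identified with the infinite lower-triangular matrix $M$ given by $M_{n,0}=a_n$, $M_{0,k}=0$ for $k\ge1$, $M_{n,k}=[x^{n-1}]g(x)f(x)^{k-1}$ for $n,k\ge1$. For a power series $h$, $(a,g,f)\cdot h$ is the power series whose coefficient sequence is $M(h_0,h_1,\dots)^T$. The group $a\mathcal R$ is the set of almost-Riordan arrays with product $(a,g,f)\cdot(b,u,v)=\big((a,g,f)\cdot b,\ g\,u(f),\ v(f)\big)$ and identity $(1,1,x)$. The Riordan group $\mathcal R$ is the set of pairs $(g,f)$ with $g_0=1$, $f_0=0$, $f_1=1$, product $(g,f)\cdot(u,v)=(g\,u(f),v(f))$, identity $(1,x)$, inverse $(g,f)^{ -1}=(1/g(\bar f),\bar f)$. -}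

module Defs where

open import Data.Nat using (ℕ; zero; suc; _∸_)
open import Data.Integer using (ℤ; _+_; _*_; 0ℤ; 1ℤ)
open import Data.Product using (_×_; Σ; _,_)
open import Relation.Binary.PropositionalEquality using (_≡_)

Series : Set
Series = ℕ → ℤ

_≈_ : Series → Series → Set
f ≈ g = ∀ n → f n ≡ g n
infix 4 _≈_

sumBelow : ℕ → (ℕ → ℤ) → ℤ
sumBelow zero    t = 0ℤ
sumBelow (suc n) t = sumBelow n t + t n

one : Series
one zero    = 1ℤ
one (suc _) = 0ℤ

X : Series
X (suc zero) = 1ℤ
X _          = 0ℤ

mul : Series → Series → Series
mul f g n = sumBelow (suc n) (λ i → f i * g (n ∸ i))

pow : Series → ℕ → Series
pow f zero    = one
pow f (suc k) = mul (pow f k) f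

-- composition u(f), meaningful when f 0 = 0:
-- [x^n] u(f) = Σ_{k ≤ n} u_k [x^n] f^k
comp : Series → Series → Series
comp u f n = sumBelow (suc n) (λ k → u k * pow f k n)

record ATriple : Set where
  constructor ⟪_,_,_⟫
  field
    A₀ : Series
    G  : Series
    F  : Series
open ATriple public

InAR : ATriple → Set
InAR ⟪ a , g , f ⟫ = (a 0 ≡ 1ℤ) × (g 0 ≡ 1ℤ) × (f 0 ≡ 0ℤ) × (f 1 ≡ 1ℤ)

entry : ATriple → ℕ → ℕ → ℤ
entry ⟪ a , g , f ⟫ n       zero    = a n
entry ⟪ a , g , f ⟫ zero    (suc k) = 0ℤ
entry ⟪ a , g , f ⟫ (suc n) (suc k) = mul g (pow f k) n

-- (a,g,f) · h : coefficient sequence M (h_0,h_1,...)^T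
-- (M is lower triangular when f_0 = 0, so the sum is over k ≤ n)
act : ATriple → Series → Series
act M h n = sumBelow (suc n) (λ k → entry M n k * h k)

_·A_ : ATriple → ATriple → ATriple
⟪ a , g , f ⟫ ·A ⟪ b , u , v ⟫ =
  ⟪ act ⟪ a , g , f ⟫ b , mul g (comp u f) , comp v f ⟫

_≈A_ : ATriple → ATriple → Set
⟪ a , g , f ⟫ ≈A ⟪ b , u , v ⟫ = (a ≈ b) × (g ≈ u) × (f ≈ v)

InN : ATriple → Set
InN ⟪ a , g , f ⟫ = (a 0 ≡ 1ℤ) × (g ≈ one) × (f ≈ X)

record RPair : Set where
  constructor ⟪_,_⟫ᵣ
  field
    RG : Series
    RF : Series
open RPair public

InR : RPair → Set
InR ⟪ g , f ⟫ᵣ = (g 0 ≡ 1ℤ) × (f 0 ≡ 0ℤ) × (f 1 ≡ 1ℤ)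

_·R_ : RPair → RPair → RPair
⟪ g , f ⟫ᵣ ·R ⟪ u , v ⟫ᵣ = ⟪ mul g (comp u f) , comp v f ⟫ᵣ

_≈R_ : RPair → RPair → Set
⟪ g , f ⟫ᵣ ≈R ⟪ u , v ⟫ᵣ = (g ≈ u) × (f ≈ v)

π : ATriple → RPair
π ⟪ a , g , f ⟫ = ⟪ g , f ⟫ᵣ

-- (a,g,f) ↦ (g,f) is a homomorphism aℛ → ℛ, and multiplying (a,g,f) on either
-- side by an element of 𝒩 changes only the first column, giving (a', g, f).
-- Conversely every first column a' with a'₀ = 1 is reached from either side:
-- from the left, (c,1,x)·a = c a₀ + (a − a₀) can be solved for c directly;
-- from the right, the matrix of (a,g,f) is lower unitriangular (its diagonal
-- entries are [xⁿ] g fⁿ = g₀ f₁ⁿ = 1), so (a,g,f)·c = a' is solvable by forward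
-- substitution. Hence the left and right 𝒩-cosets of (a,g,f) are both the set of
-- arrays over (g,f), which is normality and the isomorphism aℛ/𝒩 ≅ ℛ at once.
module Submission where

open import Defs
open import Data.Empty using (⊥-elim)
open import Data.Integer using (ℤ; 0ℤ; 1ℤ; _+_; _*_; _-_)
import Data.Integer.Properties as ℤ
open import Data.Integer.Solver using (module +-*-Solver)
open import Data.Nat using (ℕ; zero; suc; _∸_; _<_; _≤_; z≤n; s≤s; _≟_; _<?_)
import Data.Nat as ℕ using (_+_)
import Data.Nat.Properties as ℕ
open import Data.Product using (_×_; Σ; _,_)
open import Function.Base using (_⟨_⟩_)
open import Function.Bundles using (_⇔_; mk⇔)
open import Relation.Binary.PropositionalEquality
open import Relation.Nullary using (Dec; yes; no)

open +-*-Solver using (solve; _:+_; _:-_; _:*_; _:=_; con)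

sumBelow-cong : ∀ n {t s : ℕ → ℤ} → (∀ i → i < n → t i ≡ s i) → sumBelow n t ≡ sumBelow n s
sumBelow-cong zero    t≡s = refl
sumBelow-cong (suc n) t≡s =
  cong₂ _+_ (sumBelow-cong n (λ i i<n → t≡s i (ℕ.m≤n⇒m≤1+n i<n))) (t≡s n ℕ.≤-refl)

sumBelow-zero : ∀ n {t : ℕ → ℤ} → (∀ i → i < n → t i ≡ 0ℤ) → sumBelow n t ≡ 0ℤ
sumBelow-zero n t≡0 = sumBelow-cong n t≡0 ⟨ trans ⟩ sumBelow-const-zero n
  where
  sumBelow-const-zero : ∀ n → sumBelow n (λ _ → 0ℤ) ≡ 0ℤ
  sumBelow-const-zero zero    = refl
  sumBelow-const-zero (suc n) = cong (_+ 0ℤ) (sumBelow-const-zero n)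

sumBelow-single : ∀ n {j} {t : ℕ → ℤ} → j < n → (∀ i → i < n → i ≢ j → t i ≡ 0ℤ) →
                  sumBelow n t ≡ t j
sumBelow-single (suc n) {j} {t} j<1+n t≡0 with n ≟ j
... | yes refl = cong (_+ t n) (sumBelow-zero n (λ i i<n → t≡0 i (ℕ.m≤n⇒m≤1+n i<n) (ℕ.<⇒≢ i<n)))
                 ⟨ trans ⟩ ℤ.+-identityˡ (t n)
... | no n≢j = cong₂ _+_ (sumBelow-single n j<n (λ i i<n → t≡0 i (ℕ.m≤n⇒m≤1+n i<n)))
                         (t≡0 n ℕ.≤-refl n≢j)
               ⟨ trans ⟩ ℤ.+-identityʳ (t j)
  where j<n = ℕ.≤∧≢⇒< (ℕ.≤-pred j<1+n) (λ j≡n → n≢j (sym j≡n))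

sumBelow-suc : ∀ n (t : ℕ → ℤ) → sumBelow (suc n) t ≡ t 0 + sumBelow n (λ k → t (suc k))
sumBelow-suc zero    t = ℤ.+-identityˡ (t 0) ⟨ trans ⟩ sym (ℤ.+-identityʳ (t 0))
sumBelow-suc (suc n) t = cong (_+ t (suc n)) (sumBelow-suc n t) ⟨ trans ⟩ ℤ.+-assoc (t 0) _ _

≈-refl : ∀ {f} → f ≈ f
≈-refl _ = refl

≈-sym : ∀ {f g} → f ≈ g → g ≈ f
≈-sym f≈g n = sym (f≈g n)

≈-trans : ∀ {f g h} → f ≈ g → g ≈ h → f ≈ h
≈-trans f≈g g≈h n = trans (f≈g n) (g≈h n)

≈A-refl : ∀ {A} → A ≈A A
≈A-refl = ≈-refl , ≈-refl , ≈-refl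

≈A-sym : ∀ {A B} → A ≈A B → B ≈A A
≈A-sym (a≈ , g≈ , f≈) = ≈-sym a≈ , ≈-sym g≈ , ≈-sym f≈

≈A-trans : ∀ {A B C} → A ≈A B → B ≈A C → A ≈A C
≈A-trans (a≈ , g≈ , f≈) (a≈′ , g≈′ , f≈′) = ≈-trans a≈ a≈′ , ≈-trans g≈ g≈′ , ≈-trans f≈ f≈′

≈R-sym : ∀ {r s} → r ≈R s → s ≈R r
≈R-sym (g≈ , f≈) = ≈-sym g≈ , ≈-sym f≈

π-cong : ∀ {A B} → A ≈A B → π A ≈R π B
π-cong (_ , g≈ , f≈) = g≈ , f≈

mul-cong : ∀ {f f′ g g′} → f ≈ f′ → g ≈ g′ → mul f g ≈ mul f′ g′
mul-cong f≈ g≈ n = sumBelow-cong (suc n) (λ i _ → cong₂ _*_ (f≈ i) (g≈ (n ∸ i)))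

pow-cong : ∀ {f f′} → f ≈ f′ → ∀ k → pow f k ≈ pow f′ k
pow-cong f≈ zero    = ≈-refl
pow-cong f≈ (suc k) = mul-cong (pow-cong f≈ k) f≈

comp-cong : ∀ {u u′ f f′} → u ≈ u′ → f ≈ f′ → comp u f ≈ comp u′ f′
comp-cong u≈ f≈ n = sumBelow-cong (suc n) (λ k _ → cong₂ _*_ (u≈ k) (pow-cong f≈ k n))

entry-cong : ∀ {A B} → A ≈A B → ∀ n k → entry A n k ≡ entry B n k
entry-cong (a≈ , g≈ , f≈) n       zero    = a≈ n
entry-cong (a≈ , g≈ , f≈) zero    (suc k) = refl
entry-cong (a≈ , g≈ , f≈) (suc n) (suc k) = mul-cong g≈ (pow-cong f≈ k) n

act-cong : ∀ {A B h h′} → A ≈A B → h ≈ h′ → act A h ≈ act B h′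
act-cong A≈B h≈ n = sumBelow-cong (suc n) (λ k _ → cong₂ _*_ (entry-cong A≈B n k) (h≈ k))

·A-cong : ∀ {A A′ B B′} → A ≈A A′ → B ≈A B′ → (A ·A B) ≈A (A′ ·A B′)
·A-cong A≈@(_ , g≈ , f≈) (b≈ , u≈ , v≈) =
  act-cong A≈ b≈ , mul-cong g≈ (comp-cong u≈ f≈) , comp-cong v≈ f≈

act-zero : ∀ {A} h → A₀ A 0 ≡ 1ℤ → act A h 0 ≡ h 0
act-zero {A} h a₀≡1 =
  ℤ.+-identityˡ _ ⟨ trans ⟩ cong (_* h 0) a₀≡1 ⟨ trans ⟩ ℤ.*-identityˡ (h 0)

-- Orders of series and the unitriangularity of almost-Riordan arrays

VanishesBelow : ℕ → Series → Set
VanishesBelow m h = ∀ j → j < m → h j ≡ 0ℤ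

∸-<-bound : ∀ {m n i j} → m ≤ i → i ≤ j → j < m ℕ.+ n → j ∸ i < n
∸-<-bound {m} {n} {i} {j} m≤i i≤j j<m+n =
  ℕ.≤-<-trans (ℕ.∸-monoʳ-≤ j m≤i)
    (subst (j ∸ m <_) (ℕ.m+n∸m≡n m n) (ℕ.∸-monoˡ-< j<m+n (ℕ.≤-trans m≤i i≤j)))

mul-vanishesBelow : ∀ {m n g h} → VanishesBelow m g → VanishesBelow n h →
                    VanishesBelow (m ℕ.+ n) (mul g h)
mul-vanishesBelow {m} {n} {g} {h} g<m h<n j j<m+n = sumBelow-zero (suc j) term
  where
  term : ∀ i → i < suc j → g i * h (j ∸ i) ≡ 0ℤ
  term i i≤j with i <? m
  ... | yes i<m = cong (_* h (j ∸ i)) (g<m i i<m) ⟨ trans ⟩ ℤ.*-zeroˡ (h (j ∸ i))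
  ... | no i≮m  = cong (g i *_) (h<n (j ∸ i) (∸-<-bound (ℕ.≮⇒≥ i≮m) (ℕ.≤-pred i≤j) j<m+n))
                  ⟨ trans ⟩ ℤ.*-zeroʳ (g i)

mul-leading : ∀ {m n g h} → VanishesBelow m g → VanishesBelow n h →
              mul g h (m ℕ.+ n) ≡ g m * h n
mul-leading {m} {n} {g} {h} g<m h<n =
  sumBelow-single (suc (m ℕ.+ n)) (s≤s (ℕ.m≤m+n m n)) term
  ⟨ trans ⟩ cong (λ k → g m * h k) (ℕ.m+n∸m≡n m n)
  where
  term : ∀ i → i < suc (m ℕ.+ n) → i ≢ m → g i * h (m ℕ.+ n ∸ i) ≡ 0ℤ
  term i i≤m+n i≢m with i <? m
  ... | yes i<m = cong (_* h (m ℕ.+ n ∸ i)) (g<m i i<m) ⟨ trans ⟩ ℤ.*-zeroˡ (h (m ℕ.+ n ∸ i))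
  ... | no i≮m  = cong (g i *_) (h<n (m ℕ.+ n ∸ i) m+n∸i<n) ⟨ trans ⟩ ℤ.*-zeroʳ (g i)
    where
    m+n∸i<n : m ℕ.+ n ∸ i < n
    m+n∸i<n = subst (m ℕ.+ n ∸ i <_) (ℕ.m+n∸m≡n m n)
                (ℕ.∸-monoʳ-< (ℕ.≤∧≢⇒< (ℕ.≮⇒≥ i≮m) (λ m≡i → i≢m (sym m≡i))) (ℕ.≤-pred i≤m+n))

module PowerOfOrderOne {f : Series} (f₀≡0 : f 0 ≡ 0ℤ) (f₁≡1 : f 1 ≡ 1ℤ) where

  f-vanishesBelow-1 : VanishesBelow 1 f
  f-vanishesBelow-1 zero    _         = f₀≡0
  f-vanishesBelow-1 (suc j) (s≤s ())

  pow-vanishesBelow : ∀ k → VanishesBelow k (pow f k)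
  pow-vanishesBelow zero    j ()
  pow-vanishesBelow (suc k) =
    subst (λ m → VanishesBelow m (pow f (suc k))) (ℕ.+-comm k 1)
      (mul-vanishesBelow (pow-vanishesBelow k) f-vanishesBelow-1)

  pow-diagonal : ∀ k → pow f k k ≡ 1ℤ
  pow-diagonal zero    = refl
  pow-diagonal (suc k) =
    cong (mul (pow f k) f) (ℕ.+-comm 1 k)
    ⟨ trans ⟩ mul-leading (pow-vanishesBelow k) f-vanishesBelow-1
    ⟨ trans ⟩ cong₂ _*_ (pow-diagonal k) f₁≡1

entry-diagonal : ∀ {A} → InAR A → ∀ n → entry A n n ≡ 1ℤ
entry-diagonal (a₀≡1 , g₀≡1 , f₀≡0 , f₁≡1) zero    = a₀≡1
entry-diagonal {⟪ a , g , f ⟫} (a₀≡1 , g₀≡1 , f₀≡0 , f₁≡1) (suc n) =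
  mul-leading {0} {g = g} (λ _ ()) (pow-vanishesBelow n) ⟨ trans ⟩ cong₂ _*_ g₀≡1 (pow-diagonal n)
  where open PowerOfOrderOne {f} f₀≡0 f₁≡1

-- Forward substitution for lower unitriangular systems

update : Series → ℕ → ℤ → Series
update h n v i with i ≟ n
... | yes _ = v
... | no _  = h i

update-same : ∀ h n v → update h n v n ≡ v
update-same h n v with n ≟ n
... | yes _   = refl
... | no n≢n = ⊥-elim (n≢n refl)

update-other : ∀ h {n} v {i} → i ≢ n → update h n v i ≡ h i
update-other h {n} v {i} i≢n with i ≟ n
... | yes i≡n = ⊥-elim (i≢n i≡n)
... | no _    = refl

module UnitriangularSystem (E : ℕ → ℕ → ℤ) (t : Series) where

  prefix : ℕ → Series
  prefix zero    = λ _ → 0ℤ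
  prefix (suc n) = update (prefix n) n (t n - sumBelow n (λ k → E n k * prefix n k))

  solution : Series
  solution n = prefix (suc n) n

  prefix-solution : ∀ {n i} → i < n → prefix n i ≡ solution i
  prefix-solution {suc n} {i} i<1+n = by-cases (i ≟ n)
    where
    by-cases : Dec (i ≡ n) → prefix (suc n) i ≡ solution i
    by-cases (yes refl) = refl
    by-cases (no i≢n)   = update-other (prefix n) _ i≢n
                          ⟨ trans ⟩ prefix-solution (ℕ.≤∧≢⇒< (ℕ.≤-pred i<1+n) i≢n)

  solution-recurrence : ∀ n → solution n ≡ t n - sumBelow n (λ k → E n k * solution k)
  solution-recurrence n =
    update-same (prefix n) n _
    ⟨ trans ⟩ cong (λ s → t n - s)
                (sumBelow-cong n (λ k k<n → cong (E n k *_) (prefix-solution k<n)))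

  solves : (∀ n → E n n ≡ 1ℤ) → ∀ n → sumBelow (suc n) (λ k → E n k * solution k) ≡ t n
  solves Eₙₙ≡1 n =
    cong₂ (λ e s → earlier + e * s) (Eₙₙ≡1 n) (solution-recurrence n)
    ⟨ trans ⟩ solve 2 (λ s t → s :+ con 1ℤ :* (t :- s) := t) refl earlier (t n)
    where earlier = sumBelow n (λ k → E n k * solution k)

act-surjective : ∀ {A} → InAR A → ∀ t → Σ Series (λ c → act A c ≈ t)
act-surjective {A} A∈aR t = solution , solves (entry-diagonal A∈aR)
  where open UnitriangularSystem (entry A) t

-- Multiplication by the normal subgroup

monomial : ℕ → Series
monomial zero              = one
monomial (suc k) zero      = 0ℤ
monomial (suc k) (suc m)   = monomial k m

monomial-diagonal : ∀ k → monomial k k ≡ 1ℤ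
monomial-diagonal zero    = refl
monomial-diagonal (suc k) = monomial-diagonal k

monomial-offDiagonal : ∀ {k m} → k ≢ m → monomial k m ≡ 0ℤ
monomial-offDiagonal {zero}  {zero}  k≢m = ⊥-elim (k≢m refl)
monomial-offDiagonal {zero}  {suc m} k≢m = refl
monomial-offDiagonal {suc k} {zero}  k≢m = refl
monomial-offDiagonal {suc k} {suc m} k≢m = monomial-offDiagonal (λ k≡m → k≢m (cong suc k≡m))

X-offOne : ∀ {k} → k ≢ 1 → X k ≡ 0ℤ
X-offOne {zero}          _   = refl
X-offOne {suc zero}      k≢1 = ⊥-elim (k≢1 refl)
X-offOne {suc (suc _)}   _   = refl

mul-identityˡ : ∀ h → mul one h ≈ h
mul-identityˡ h n = sumBelow-single (suc n) (s≤s z≤n) term ⟨ trans ⟩ ℤ.*-identityˡ (h n)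
  where
  term : ∀ i → i < suc n → i ≢ 0 → one i * h (n ∸ i) ≡ 0ℤ
  term zero    _ i≢0 = ⊥-elim (i≢0 refl)
  term (suc i) _ _   = refl

mul-identityʳ : ∀ h → mul h one ≈ h
mul-identityʳ h n =
  sumBelow-single (suc n) ℕ.≤-refl term
  ⟨ trans ⟩ cong (λ k → h n * one k) (ℕ.n∸n≡0 n) ⟨ trans ⟩ ℤ.*-identityʳ (h n)
  where
  term : ∀ i → i < suc n → i ≢ n → h i * one (n ∸ i) ≡ 0ℤ
  term i i≤n i≢n = cong (h i *_) (monomial-offDiagonal {0} (ℕ.<⇒≢ 0<n∸i)) ⟨ trans ⟩ ℤ.*-zeroʳ (h i)
    where 0<n∸i = ℕ.m<n⇒0<n∸m (ℕ.≤∧≢⇒< (ℕ.≤-pred i≤n) i≢n)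

mul-X-zero : ∀ h → mul h X 0 ≡ 0ℤ
mul-X-zero h = ℤ.+-identityˡ _ ⟨ trans ⟩ ℤ.*-zeroʳ (h 0)

mul-X-suc : ∀ h m → mul h X (suc m) ≡ h m
mul-X-suc h m =
  sumBelow-single (suc (suc m)) (ℕ.n≤1+n (suc m)) term
  ⟨ trans ⟩ cong (λ k → h m * X k) (ℕ.m+n∸n≡m 1 m) ⟨ trans ⟩ ℤ.*-identityʳ (h m)
  where
  term : ∀ i → i < suc (suc m) → i ≢ m → h i * X (suc m ∸ i) ≡ 0ℤ
  term i i≤1+m i≢m = cong (h i *_) (X-offOne 1+m∸i≢1) ⟨ trans ⟩ ℤ.*-zeroʳ (h i)
    where
    1+m∸i≢1 : suc m ∸ i ≢ 1
    1+m∸i≢1 eq = i≢m (ℕ.suc-injective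
                   (cong (ℕ._+ i) (sym eq) ⟨ trans ⟩ ℕ.m∸n+n≡m (ℕ.≤-pred i≤1+m)))

pow-X : ∀ k → pow X k ≈ monomial k
pow-X zero    zero    = refl
pow-X zero    (suc m) = refl
pow-X (suc k) zero    = mul-X-zero (pow X k)
pow-X (suc k) (suc m) = mul-X-suc (pow X k) m ⟨ trans ⟩ pow-X k m

comp-identityʳ : ∀ g → comp g X ≈ g
comp-identityʳ g n =
  sumBelow-single (suc n) ℕ.≤-refl term
  ⟨ trans ⟩ cong (g n *_) (pow-X n n ⟨ trans ⟩ monomial-diagonal n) ⟨ trans ⟩ ℤ.*-identityʳ (g n)
  where
  term : ∀ i → i < suc n → i ≢ n → g i * pow X i n ≡ 0ℤ
  term i _ i≢n = cong (g i *_) (pow-X i n ⟨ trans ⟩ monomial-offDiagonal i≢n) ⟨ trans ⟩ ℤ.*-zeroʳ (g i)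

comp-identityˡ : ∀ {f} → f 0 ≡ 0ℤ → comp X f ≈ f
comp-identityˡ f₀≡0 zero    = ℤ.+-identityˡ _ ⟨ trans ⟩ sym f₀≡0
comp-identityˡ {f} f₀≡0 (suc n) =
  sumBelow-single (suc (suc n)) (s≤s (s≤s z≤n)) term
  ⟨ trans ⟩ ℤ.*-identityˡ _ ⟨ trans ⟩ mul-identityˡ f (suc n)
  where
  term : ∀ i → i < suc (suc n) → i ≢ 1 → X i * pow f i (suc n) ≡ 0ℤ
  term zero          _ _   = refl
  term (suc zero)    _ i≢1 = ⊥-elim (i≢1 refl)
  term (suc (suc i)) _ _   = refl

comp-oneˡ : ∀ f → comp one f ≈ one
comp-oneˡ f n = sumBelow-single (suc n) (s≤s z≤n) term ⟨ trans ⟩ ℤ.*-identityˡ (one n)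
  where
  term : ∀ i → i < suc n → i ≢ 0 → one i * pow f i n ≡ 0ℤ
  term zero    _ i≢0 = ⊥-elim (i≢0 refl)
  term (suc i) _ _   = refl

act-normal-suc : ∀ c h m → act ⟪ c , one , X ⟫ h (suc m) ≡ c (suc m) * h 0 + h (suc m)
act-normal-suc c h m =
  sumBelow-suc (suc m) _
  ⟨ trans ⟩ cong (c (suc m) * h 0 +_)
      (sumBelow-single (suc m) ℕ.≤-refl term
       ⟨ trans ⟩ cong (_* h (suc m)) (entry-normal m ⟨ trans ⟩ monomial-diagonal m)
       ⟨ trans ⟩ ℤ.*-identityˡ (h (suc m)))
  where
  entry-normal : ∀ k → mul one (pow X k) m ≡ monomial k m
  entry-normal k = mul-identityˡ (pow X k) m ⟨ trans ⟩ pow-X k m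

  term : ∀ k → k < suc m → k ≢ m → mul one (pow X k) m * h (suc k) ≡ 0ℤ
  term k _ k≢m = cong (_* h (suc k)) (entry-normal k ⟨ trans ⟩ monomial-offDiagonal k≢m)
                 ⟨ trans ⟩ ℤ.*-zeroˡ (h (suc k))

InN⇒≈A-normal : ∀ {n} → InN n → n ≈A ⟪ A₀ n , one , X ⟫
InN⇒≈A-normal (_ , u≈1 , v≈X) = ≈-refl , u≈1 , v≈X

·A-normalʳ : ∀ {a g f} b → f 0 ≡ 0ℤ →
             (⟪ a , g , f ⟫ ·A ⟪ b , one , X ⟫) ≈A ⟪ act ⟪ a , g , f ⟫ b , g , f ⟫
·A-normalʳ {g = g} {f} b f₀≡0 =
  ≈-refl , ≈-trans (mul-cong (≈-refl {g}) (comp-oneˡ f)) (mul-identityʳ g) , comp-identityˡ f₀≡0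

·A-normalˡ : ∀ c {a g f} → (⟪ c , one , X ⟫ ·A ⟪ a , g , f ⟫) ≈A ⟪ act ⟪ c , one , X ⟫ a , g , f ⟫
·A-normalˡ c {g = g} {f} =
  ≈-refl , ≈-trans (mul-identityˡ (comp g X)) (comp-identityʳ g) , comp-identityʳ f

·A-Nʳ : ∀ {A n} → F A 0 ≡ 0ℤ → InN n → (A ·A n) ≈A ⟪ act A (A₀ n) , G A , F A ⟫
·A-Nʳ {A} {n} f₀≡0 n∈N = ≈A-trans (·A-cong (≈A-refl {A}) (InN⇒≈A-normal n∈N)) (·A-normalʳ (A₀ n) f₀≡0)

·A-Nˡ : ∀ {A n} → InN n → (n ·A A) ≈A ⟪ act ⟪ A₀ n , one , X ⟫ (A₀ A) , G A , F A ⟫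
·A-Nˡ {A} {n} n∈N = ≈A-trans (·A-cong (InN⇒≈A-normal n∈N) (≈A-refl {A})) (·A-normalˡ (A₀ n))

rightCoset : ∀ {A B} → InAR A → A₀ B 0 ≡ 1ℤ → π A ≈R π B →
             Σ ATriple (λ n → InN n × (B ≈A (A ·A n)))
rightCoset {A} {B} A∈aR@(a₀≡1 , _ , f₀≡0 , _) b₀≡1 (g≈u , f≈v)
  with act-surjective A∈aR (A₀ B)
... | c , Ac≈b =
  ⟪ c , one , X ⟫ , (c₀≡1 , ≈-refl , ≈-refl) ,
  ≈A-sym (≈A-trans (·A-normalʳ c f₀≡0) (Ac≈b , g≈u , f≈v))
  where
  c₀≡1 : c 0 ≡ 1ℤ
  c₀≡1 = sym (act-zero {A} c a₀≡1) ⟨ trans ⟩ Ac≈b 0 ⟨ trans ⟩ b₀≡1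

leftCoset : ∀ {A B} → InAR A → A₀ B 0 ≡ 1ℤ → π A ≈R π B →
            Σ ATriple (λ n → InN n × (B ≈A (n ·A A)))
leftCoset {A} {B} (a₀≡1 , _) b₀≡1 (g≈u , f≈v) =
  ⟪ c , one , X ⟫ , (refl , ≈-refl , ≈-refl) ,
  ≈A-sym (≈A-trans (·A-normalˡ c) (ca≈b , g≈u , f≈v))
  where
  c : Series
  c zero    = 1ℤ
  c (suc m) = A₀ B (suc m) - A₀ A (suc m)

  ca≈b : act ⟪ c , one , X ⟫ (A₀ A) ≈ A₀ B
  ca≈b zero    = act-zero {⟪ c , one , X ⟫} (A₀ A) refl ⟨ trans ⟩ a₀≡1 ⟨ trans ⟩ sym b₀≡1
  ca≈b (suc m) =
    act-normal-suc c (A₀ A) m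
    ⟨ trans ⟩ cong (λ a₀ → c (suc m) * a₀ + A₀ A (suc m)) a₀≡1
    ⟨ trans ⟩ solve 2 (λ b a → (b :- a) :* con 1ℤ :+ a := b) refl (A₀ B (suc m)) (A₀ A (suc m))

mainTheorem8 : ((A n : ATriple) → InAR A → InN n →
    Σ ATriple (λ n′ → InN n′ × ((A ·A n) ≈A (n′ ·A A))))
    ×
    ((A n : ATriple) → InAR A → InN n →
    Σ ATriple (λ n′ → InN n′ × ((n ·A A) ≈A (A ·A n′))))
    ×
    ((A B : ATriple) → InAR A → InAR B →
    (Σ ATriple (λ n → InN n × (B ≈A (A ·A n)))) ⇔ (π A ≈R π B))
    ×
    ((A B : ATriple) → InAR A → InAR B → π (A ·A B) ≈R (π A ·R π B))
    ×
    ((r : RPair) → InR r → Σ ATriple (λ A → InAR A × (π A ≈R r)))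
mainTheorem8 =
  (λ A n A∈aR@(a₀≡1 , _ , f₀≡0 , _) n∈N@(b₀≡1 , _) →
    leftCoset A∈aR (act-zero {A} (A₀ n) a₀≡1 ⟨ trans ⟩ b₀≡1)
      (≈R-sym (π-cong {A ·A n} (·A-Nʳ {A} f₀≡0 n∈N)))) ,
  (λ A n A∈aR@(a₀≡1 , _) n∈N@(b₀≡1 , _) →
    rightCoset {A} A∈aR (act-zero {⟪ A₀ n , one , X ⟫} (A₀ A) b₀≡1 ⟨ trans ⟩ a₀≡1)
      (≈R-sym (π-cong {n ·A A} (·A-Nˡ {A} n∈N)))) ,
  (λ A B A∈aR@(_ , _ , f₀≡0 , _) (b₀≡1 , _) → mk⇔
    (λ (n , n∈N , B≈An) → ≈R-sym (π-cong (≈A-trans B≈An (·A-Nʳ {A} f₀≡0 n∈N))))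
    (rightCoset A∈aR b₀≡1)) ,
  (λ A B _ _ → ≈-refl , ≈-refl) ,
  (λ r (g₀≡1 , f₀≡0 , f₁≡1) → ⟪ one , RG r , RF r ⟫ , (refl , g₀≡1 , f₀≡0 , f₁≡1) , ≈-refl , ≈-refl)
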